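{- Let $G$ be a group with no elements of order $2$, and let $A \subseteq G$ be a finite subset. Then $|AA^{ -1}| - |A^{ -1}A|$ is even.
   Context: For a finite subset $A$ of a group $G$, the right quotient set is $AA^{ -1} = \{a b^{ -1} : a, b \in A\}$ and the left quotient set is $A^{ -1}A = \{a^{ -1} b : a, b \in A\}$. -}

module Defs where

open import Level using (Level; _⊔_)
open import Data.Nat using (ℕ)
open import Data.List using (List; length)
open import Data.List.Relation.Unary.Any using (Any)
open import Data.Product using (Σ; ∃; ∃-syntax; _×_)
open import Function.Bundles using (_⇔_)
open import Relation.Nullary using (¬_)
open import Relation.Binary.Bundles using (Setoid)
open import Relation.Binary.PropositionalEquality using (_≡_)
open import Algebra.Bundles using (Group)
import Data.List.Membership.Setoid as SetoidMembership
import Data.List.Relation.Unary.Unique.Setoid as SetoidUnique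

module _ {c ℓ : Level} (S : Setoid c ℓ) where
  open Setoid S renaming (Carrier to X)
  open SetoidMembership S using () renaming (_∈_ to _∈ₛ_)
  open SetoidUnique S using (Unique)

  -- A subset P of the setoid S (closed under ≈ by construction at use sites)
  -- is finite with exactly n elements (counted up to ≈): it is enumerated by a
  -- list of length n without repetitions (w.r.t. ≈).
  HasCard : ∀ {p} → (X → Set p) → ℕ → Set (c ⊔ ℓ ⊔ p)
  HasCard P n = Σ (List X) λ xs →
    (length xs ≡ n) × Unique xs × (∀ x → (x ∈ₛ xs) ⇔ P x)

module _ {c ℓ : Level} (G : Group c ℓ) where
  open Group G

  NoOrderTwo : Set (c ⊔ ℓ)
  NoOrderTwo = ∀ g → g ∙ g ≈ ε → g ≈ ε

  InRightQuot : List Carrier → Carrier → Set (c ⊔ ℓ)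
  InRightQuot A x = ∃[ a ] ∃[ b ] (Any (a ≡_) A × Any (b ≡_) A × (x ≈ a ∙ b ⁻¹))

  InLeftQuot : List Carrier → Carrier → Set (c ⊔ ℓ)
  InLeftQuot A x = ∃[ a ] ∃[ b ] (Any (a ≡_) A × Any (b ≡_) A × (x ≈ a ⁻¹ ∙ b))

-- Inversion x ↦ x⁻¹ is an involution of G that maps AA⁻¹ and A⁻¹A onto themselves.
-- A finite set stable under an involution splits into orbits of size two and the
-- fixed points. Without elements of order 2 the only fixed point of inversion is
-- the identity, which lies in both quotient sets when A is non-empty; so both
-- cardinalities are odd, and their difference is even.
module Submission where

open import Defs
open import Level using (Level; _⊔_)
open import Data.Nat using (ℕ; suc; _<_)
open import Data.Nat.Properties using (≤-reflexive; m<n⇒m<1+n)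
open import Data.Nat.Induction using (<-wellFounded)
open import Data.Nat.Divisibility as ℕ using (_∣0; ∣-refl)
open import Data.List using (List; []; _∷_; length)
open import Data.List.Properties using (length-removeAt′)
open import Data.List.Relation.Unary.Any using (Any; here; there; index; _─_)
open import Data.List.Relation.Unary.All using (All; _∷_)
open import Data.List.Relation.Unary.AllPairs using (AllPairs; _∷_)
open import Data.Integer using (+_; _-_)
open import Data.Integer.Divisibility using (_∣_)
import Data.Integer.Divisibility.Signed as Signed
open import Data.Integer.Properties using ([1+m]⊖[1+n]≡m⊖n; m-n≡m⊖n)
open import Data.Product using (_,_)
open import Data.Sum using (_⊎_; inj₁; inj₂)
open import Data.Empty using (⊥-elim)
open import Function using (_∘_)
open import Function.Bundles using (Equivalence)
open import Induction.WellFounded using (Acc; acc)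
open import Relation.Nullary using (¬_)
open import Relation.Binary using (Rel; Setoid)
open import Relation.Binary.PropositionalEquality as ≡ using (_≡_; refl; subst)
open import Algebra.Bundles using (Group)
open import Algebra.Definitions using (Congruent₁; Involutive)
import Algebra.Properties.Group as GroupProperties
import Data.List.Membership.Setoid as SetoidMembership
import Data.List.Relation.Unary.Unique.Setoid as SetoidUnique
open import Data.List.Membership.Setoid.Properties using (∈-resp-≈; All[≉]⇒∉)

∣1+m∣1+n⇒∣m-n : ∀ {k m n} → k ℕ.∣ suc m → k ℕ.∣ suc n → + k ∣ + m - + n
∣1+m∣1+n⇒∣m-n {k} {m} {n} k∣1+m k∣1+n =
  Signed.∣⇒∣ᵤ (subst (Signed._∣_ (+ k)) [1+m]-[1+n]≡m-n
    (Signed.∣m∣n⇒∣m-n (Signed.∣ᵤ⇒∣ {i = + suc m} k∣1+m) (Signed.∣ᵤ⇒∣ {i = + suc n} k∣1+n)))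
  where
  [1+m]-[1+n]≡m-n : + suc m - + suc n ≡ + m - + n
  [1+m]-[1+n]≡m-n = ≡.trans ([1+m]⊖[1+n]≡m⊖n m n) (≡.sym (m-n≡m⊖n m n))

module _ {a q} {A : Set a} {Q : A → Set q} where

  All-─ : ∀ {p} {P : A → Set p} {xs} (i : Any Q xs) → All P xs → All P (xs ─ i)
  All-─ (here _)  (_ ∷ pxs)  = pxs
  All-─ (there i) (px ∷ pxs) = px ∷ All-─ i pxs

  AllPairs-─ : ∀ {r} {R : Rel A r} {xs} (i : Any Q xs) → AllPairs R xs → AllPairs R (xs ─ i)
  AllPairs-─ (here _)  (_ ∷ rxs)  = rxs
  AllPairs-─ (there i) (rx ∷ rxs) = All-─ i rx ∷ AllPairs-─ i rxs

module _ {c ℓ} (S : Setoid c ℓ) where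
  open Setoid S renaming (refl to ≈-refl)
  open SetoidMembership S using (_∈_; _∉_)
  open SetoidUnique S using (Unique)

  ∈-─⁻ : ∀ {v w xs} (v∈xs : v ∈ xs) → w ∈ (xs ─ v∈xs) → w ∈ xs
  ∈-─⁻ (here _)     w∈         = there w∈
  ∈-─⁻ (there v∈xs) (here w≈x) = here w≈x
  ∈-─⁻ (there v∈xs) (there w∈) = there (∈-─⁻ v∈xs w∈)

  ∈⇒≈⊎∈-─ : ∀ {v w xs} (v∈xs : v ∈ xs) → w ∈ xs → w ≈ v ⊎ w ∈ (xs ─ v∈xs)
  ∈⇒≈⊎∈-─ (here v≈x)   (here w≈x) = inj₁ (trans w≈x (sym v≈x))
  ∈⇒≈⊎∈-─ (here _)     (there w∈) = inj₂ w∈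
  ∈⇒≈⊎∈-─ (there _)    (here w≈x) = inj₂ (here w≈x)
  ∈⇒≈⊎∈-─ (there v∈xs) (there w∈) with ∈⇒≈⊎∈-─ v∈xs w∈
  ... | inj₁ w≈v   = inj₁ w≈v
  ... | inj₂ w∈xs─ = inj₂ (there w∈xs─)

  ∉-─ : ∀ {v xs} → Unique xs → (v∈xs : v ∈ xs) → v ∉ (xs ─ v∈xs)
  ∉-─ (x≉ys ∷ _) (here v≈x)   v∈ys       = All[≉]⇒∉ S x≉ys (∈-resp-≈ S v≈x v∈ys)
  ∉-─ (x≉ys ∷ _) (there v∈ys) (here v≈x) = All[≉]⇒∉ S x≉ys (∈-resp-≈ S v≈x v∈ys)
  ∉-─ (_ ∷ ys!)  (there v∈ys) (there v∈) = ∉-─ ys! v∈ys v∈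

  HasCard-empty : ∀ {p} {P : Carrier → Set p} {n} → (∀ x → ¬ P x) → HasCard S P n → n ≡ 0
  HasCard-empty ¬P ([]    , refl , _)         = refl
  HasCard-empty ¬P (x ∷ _ , _    , _ , ∈⇔P) = ⊥-elim (¬P x (Equivalence.to (∈⇔P x) (here ≈-refl)))

module InvolutionParity {c ℓ} (S : Setoid c ℓ) (f : Setoid.Carrier S → Setoid.Carrier S)
  (f-cong : Congruent₁ (Setoid._≈_ S) f) (f-involutive : Involutive (Setoid._≈_ S) f) where

  open Setoid S renaming (refl to ≈-refl)
  open SetoidMembership S using (_∈_)
  open SetoidUnique S using (Unique)

  Closed : List Carrier → Set (c ⊔ ℓ)
  Closed xs = ∀ {x} → x ∈ xs → f x ∈ xs

  FixedPointFree : List Carrier → Set (c ⊔ ℓ)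
  FixedPointFree xs = ∀ {x} → x ∈ xs → ¬ f x ≈ x

  f-injective : ∀ {x y} → f x ≈ f y → x ≈ y
  f-injective {x} {y} fx≈fy = trans (sym (f-involutive x)) (trans (f-cong fx≈fy) (f-involutive y))

  f-swap : ∀ {x y} → f x ≈ y → x ≈ f y
  f-swap {y = y} fx≈y = f-injective (trans fx≈y (sym (f-involutive y)))

  even-length : ∀ {xs} → Unique xs → Closed xs → FixedPointFree xs → 2 ℕ.∣ length xs
  even-length {xs} = go xs (<-wellFounded (length xs))
    where
    go : ∀ xs → Acc _<_ (length xs) → Unique xs → Closed xs → FixedPointFree xs →
         2 ℕ.∣ length xs
    go []       _         _            _      _   = 2 ∣0
    go (x ∷ ys) (acc rec) (x≉ys ∷ ys!) closed fpf with closed (here ≈-refl)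
    ... | here fx≈x   = ⊥-elim (fpf (here ≈-refl) fx≈x)
    ... | there fx∈ys = subst (λ k → 2 ℕ.∣ suc k) (≡.sym |ys|≡1+|zs|)
                          (ℕ.∣m∣n⇒∣m+n ∣-refl (go zs (rec |zs|<|x∷ys|) zs! zs-closed zs-fpf))
      where
      zs = ys ─ fx∈ys

      |ys|≡1+|zs| : length ys ≡ suc (length zs)
      |ys|≡1+|zs| = length-removeAt′ ys (index fx∈ys)

      |zs|<|x∷ys| : length zs < length (x ∷ ys)
      |zs|<|x∷ys| = m<n⇒m<1+n (≤-reflexive (≡.sym |ys|≡1+|zs|))

      zs! : Unique zs
      zs! = AllPairs-─ fx∈ys ys!

      zs-fpf : FixedPointFree zs
      zs-fpf = fpf ∘ there ∘ ∈-─⁻ S fx∈ys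

      zs-closed : Closed zs
      zs-closed {z} z∈zs with closed (there (∈-─⁻ S fx∈ys z∈zs))
      ... | here fz≈x  = ⊥-elim (∉-─ S ys! fx∈ys (∈-resp-≈ S (f-swap fz≈x) z∈zs))
      ... | there fz∈ys with ∈⇒≈⊎∈-─ S fx∈ys fz∈ys
      ...   | inj₁ fz≈fx = ⊥-elim (All[≉]⇒∉ S x≉ys
                             (∈-resp-≈ S (f-injective fz≈fx) (∈-─⁻ S fx∈ys z∈zs)))
      ...   | inj₂ fz∈zs = fz∈zs

  odd-length : ∀ {xs z} → Unique xs → Closed xs → z ∈ xs → f z ≈ z →
               (∀ {x} → f x ≈ x → x ≈ z) → 2 ℕ.∣ suc (length xs)
  odd-length {xs} xs! closed z∈xs fz≈z fixed⇒≈z =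
    subst (λ k → 2 ℕ.∣ suc k) (≡.sym (length-removeAt′ xs (index z∈xs)))
      (ℕ.∣m∣n⇒∣m+n ∣-refl (even-length (AllPairs-─ z∈xs xs!) rest-closed rest-fpf))
    where
    rest = xs ─ z∈xs

    rest-fpf : FixedPointFree rest
    rest-fpf w∈ fw≈w = ∉-─ S xs! z∈xs (∈-resp-≈ S (fixed⇒≈z fw≈w) w∈)

    rest-closed : Closed rest
    rest-closed w∈ with ∈⇒≈⊎∈-─ S z∈xs (closed (∈-─⁻ S z∈xs w∈))
    ... | inj₁ fw≈z = ⊥-elim (∉-─ S xs! z∈xs (∈-resp-≈ S (trans (f-swap fw≈z) fz≈z) w∈))
    ... | inj₂ fw∈  = fw∈

  HasCard-odd : ∀ {p} {P : Carrier → Set p} {n z} → (∀ {x} → P x → P (f x)) →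
                P z → f z ≈ z → (∀ {x} → f x ≈ x → x ≈ z) → HasCard S P n → 2 ℕ.∣ suc n
  HasCard-odd P-closed Pz fz≈z fixed⇒≈z (xs , refl , xs! , ∈⇔P) =
    odd-length xs! (∈⇔P _ .from ∘ P-closed ∘ ∈⇔P _ .to) (∈⇔P _ .from Pz) fz≈z fixed⇒≈z
    where open Equivalence

module _ {c ℓ} (G : Group c ℓ) where
  open Group G hiding (refl)
  open GroupProperties G using (⁻¹-involutive; ε⁻¹≈ε; ⁻¹-anti-homo-//; ⁻¹-anti-homo-\\)
  open InvolutionParity setoid _⁻¹ ⁻¹-cong ⁻¹-involutive using (HasCard-odd)

  InRightQuot-⁻¹ : ∀ {A x} → InRightQuot G A x → InRightQuot G A (x ⁻¹)
  InRightQuot-⁻¹ (a , b , a∈A , b∈A , x≈a//b) =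
    b , a , b∈A , a∈A , trans (⁻¹-cong x≈a//b) (⁻¹-anti-homo-// a b)

  InLeftQuot-⁻¹ : ∀ {A x} → InLeftQuot G A x → InLeftQuot G A (x ⁻¹)
  InLeftQuot-⁻¹ (a , b , a∈A , b∈A , x≈a\\b) =
    b , a , b∈A , a∈A , trans (⁻¹-cong x≈a\\b) (⁻¹-anti-homo-\\ a b)

  NoOrderTwo⇒⁻¹-fixed⇒ε : NoOrderTwo G → ∀ {x} → x ⁻¹ ≈ x → x ≈ ε
  NoOrderTwo⇒⁻¹-fixed⇒ε no2 {x} x⁻¹≈x = no2 x (trans (∙-congˡ (sym x⁻¹≈x)) (inverseʳ x))

  rightQuot-card-odd : NoOrderTwo G → ∀ {a A m} →
                       HasCard setoid (InRightQuot G (a ∷ A)) m → 2 ℕ.∣ suc m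
  rightQuot-card-odd no2 {a} = HasCard-odd InRightQuot-⁻¹
    (a , a , here refl , here refl , sym (inverseʳ a)) ε⁻¹≈ε (NoOrderTwo⇒⁻¹-fixed⇒ε no2)

  leftQuot-card-odd : NoOrderTwo G → ∀ {a A n} →
                      HasCard setoid (InLeftQuot G (a ∷ A)) n → 2 ℕ.∣ suc n
  leftQuot-card-odd no2 {a} = HasCard-odd InLeftQuot-⁻¹
    (a , a , here refl , here refl , sym (inverseˡ a)) ε⁻¹≈ε (NoOrderTwo⇒⁻¹-fixed⇒ε no2)

theorem1p3 : ∀ {c ℓ : Level} (G : Group c ℓ) → NoOrderTwo G →
    (A : List (Group.Carrier G)) (m n : ℕ) →
    HasCard (Group.setoid G) (InRightQuot G A) m →
    HasCard (Group.setoid G) (InLeftQuot G A) n →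
    (+ 2) ∣ (+ m - + n)
theorem1p3 G no2 [] m n right left
  rewrite HasCard-empty (Group.setoid G) (λ _ → λ { (_ , _ , () , _) }) right
        | HasCard-empty (Group.setoid G) (λ _ → λ { (_ , _ , () , _) }) left = 2 ∣0
theorem1p3 G no2 (a ∷ A) m n right left =
  ∣1+m∣1+n⇒∣m-n (rightQuot-card-odd G no2 right) (leftQuot-card-odd G no2 left)
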